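{- Let $j,r,k$ be non-negative integers with $j+r\le k$. Let $\mathcal{Y}^o_{j,r,k}$ be the set of generalised frequency sequences $(f_i)_{i\in\mathbb Z}$ such that $f_i+f_{i+1}\le k$ for all $i\ge0$, $f_i=0$ for all $i<0$, $f_0\in\{\ell+\max\{\ell-(j-r),0\}:0\le\ell\le j\}$, and $f_i$ is even whenever $i$ is odd. Let $\mathcal{Z}^o_{j,r,k}$ be the set of generalised frequency sequences $(f_i)_{i\in\mathbb Z}$ such that $f_i+f_{i+1}\le k$ for all $i\ge0$, $f_i=0$ for all $i<0$, $f_0\le j$ and $2f_0+f_1\le k-r+j$, and $f_i$ is even whenever $i$ is odd. Then there exists a weight-preserving bijection between $\mathcal{Y}^o_{j,r,k}$ and $\mathcal{Z}^o_{j,r,k}$.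
   Context: A generalised frequency sequence is a sequence $(f_i)_{i\in\mathbb Z}$ of non-negative integers with finitely many non-zero terms ($f_i$ = multiplicity of the part $i$), of weight $|f|=\sum_i if_i$. -}

module Defs where

open import Data.Nat as ℕ using (ℕ; zero; suc; _≤_; _⊔_; _∸_)
open import Data.Integer as ℤ using (ℤ; +_; -[1+_]; ∣_∣)
open import Data.Product using (Σ; ∃; _×_; _,_; proj₁; proj₂)
open import Data.Nat.Divisibility using (_∣_)
open import Relation.Nullary using (¬_)
open import Relation.Binary.PropositionalEquality using (_≡_)

record GFS : Set where
  constructor gfs
  field
    seq     : ℤ → ℕ
    bound   : ℕ
    support : ∀ (i : ℤ) → bound ≤ ∣ i ∣ → seq i ≡ 0
open GFS public

sumSym : (ℤ → ℕ) → ℕ → ℤ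
sumSym f zero    = ℤ.0ℤ
sumSym f (suc n) =
  (+ (suc n) ℤ.* + f (+ suc n)) ℤ.+ (-[1+ n ] ℤ.* + f -[1+ n ]) ℤ.+ sumSym f n

-- weight |f| = Σ_i i f_i (the sum is over the finite support; the terms
-- with |i| ≥ bound vanish, so the value does not depend on the chosen bound)
weight : GFS → ℤ
weight f = sumSym (seq f) (bound f)

_≈_ : GFS → GFS → Set
f ≈ g = ∀ (i : ℤ) → seq f i ≡ seq g i

Common : ℕ → GFS → Set
Common k f =
  (∀ (i : ℕ) → seq f (+ i) ℕ.+ seq f (+ suc i) ≤ k) ×
  (∀ (n : ℕ) → seq f -[1+ n ] ≡ 0) ×
  (∀ (i : ℕ) → ¬ (2 ∣ i) → 2 ∣ seq f (+ i))

-- f₀ ∈ { ℓ + max{ℓ - (j - r), 0} : 0 ≤ ℓ ≤ j }  (r ≤ j is not assumed, so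
-- j - r is computed as an integer to be exact)
InY₀ : ℕ → ℕ → ℕ → Set
InY₀ j r x = Σ ℕ λ ℓ → (ℓ ≤ j) ×
  (+ x ≡ + ℓ ℤ.+ ((+ ℓ ℤ.- (+ j ℤ.- + r)) ℤ.⊔ ℤ.0ℤ))

Y° : ℕ → ℕ → ℕ → GFS → Set
Y° j r k f = Common k f × InY₀ j r (seq f (+ 0))

-- 2 f₀ + f₁ ≤ k - r + j  (integer arithmetic, exact)
Z° : ℕ → ℕ → ℕ → GFS → Set
Z° j r k f = Common k f × (seq f (+ 0) ≤ j) ×
  (+ (2 ℕ.* seq f (+ 0) ℕ.+ seq f (+ 1)) ℤ.≤ (+ k ℤ.- + r ℤ.+ + j))

Yset : ℕ → ℕ → ℕ → Set
Yset j r k = Σ GFS (Y° j r k)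

Zset : ℕ → ℕ → ℕ → Set
Zset j r k = Σ GFS (Z° j r k)

-- a weight-preserving bijection between { f | P f } and { f | Q f }, where
-- generalised frequency sequences are identified when their underlying
-- sequences agree pointwise (the bound field is mere bookkeeping)
record WeightPreservingBijection (P Q : GFS → Set) : Set where
  field
    to      : Σ GFS P → Σ GFS Q
    from    : Σ GFS Q → Σ GFS P
    to-cong   : ∀ x y → proj₁ x ≈ proj₁ y → proj₁ (to x) ≈ proj₁ (to y)
    from-cong : ∀ x y → proj₁ x ≈ proj₁ y → proj₁ (from x) ≈ proj₁ (from y)
    from∘to : ∀ x → proj₁ (from (to x)) ≈ proj₁ x
    to∘from : ∀ y → proj₁ (to (from y)) ≈ proj₁ y
    to-weight : ∀ x → weight (proj₁ (to x)) ≡ weight (proj₁ x)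

{-# OPTIONS --safe #-}
-- Index 0 contributes nothing to the weight, so replacing f₀ alone preserves it.
-- The bijection keeps f off index 0 and exchanges f₀ = y₀(ℓ) = ℓ + max(ℓ + r − j, 0)
-- with f₀ = ℓ. As y₀ is strictly increasing this is a bijection on the admissible values
-- of f₀, and y₀(ℓ) + f₁ ≤ k holds exactly when both ℓ + f₁ ≤ k and 2ℓ + f₁ ≤ k − r + j,
-- so the constraints at index 0 correspond.
module Submission where

open import Defs
open import Data.Nat using (ℕ; _+_; _≤_)
open import Data.Nat using (zero; suc; _∸_; _<_; _*_; z≤n)
import Data.Nat.Properties as ℕₚ
open import Data.Nat.Divisibility using (_∣_; _∣0)
open import Data.Nat.Tactic.RingSolver using () renaming (solve-∀ to ℕ-solve-∀)
open import Data.Integer as ℤ using (ℤ; +_; -[1+_]; ∣_∣; +≤+)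
import Data.Integer.Properties as ℤₚ
open import Data.Integer.Tactic.RingSolver using () renaming (solve-∀ to ℤ-solve-∀)
open import Data.Product using (Σ; _×_; _,_; proj₁; proj₂)
open import Data.Sum using (inj₁; inj₂)
open import Function.Bundles using (_⇔_; mk⇔; module Equivalence)
open import Relation.Binary.Definitions using (tri<; tri≈; tri>)
open import Relation.Binary.PropositionalEquality
open import Relation.Nullary using (¬_; contradiction)

setHead : (ℤ → ℕ) → ℕ → ℤ → ℕ
setHead f x (+ zero)  = x
setHead f x (+ suc n) = f (+ suc n)
setHead f x -[1+ n ]  = f -[1+ n ]

withHead : GFS → ℕ → GFS
withHead f x = gfs (setHead (seq f) x) (suc (bound f)) vanishes
  where
  vanishes : ∀ i → suc (bound f) ≤ ∣ i ∣ → setHead (seq f) x i ≡ 0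
  vanishes (+ zero)  ()
  vanishes (+ suc n) b<n = support f (+ suc n) (ℕₚ.<⇒≤ b<n)
  vanishes -[1+ n ]  b<n = support f -[1+ n ] (ℕₚ.<⇒≤ b<n)

withHead-cong : ∀ f h {x y} → f ≈ h → x ≡ y → withHead f x ≈ withHead h y
withHead-cong _ _ f≈h x≡y (+ zero)  = x≡y
withHead-cong _ _ f≈h x≡y (+ suc n) = f≈h (+ suc n)
withHead-cong _ _ f≈h x≡y -[1+ n ]  = f≈h -[1+ n ]

withHead-withHead : ∀ f x {y} → y ≡ seq f (+ 0) → withHead (withHead f x) y ≈ f
withHead-withHead _ _ y≡f₀ (+ zero)  = y≡f₀
withHead-withHead _ _ y≡f₀ (+ suc n) = refl
withHead-withHead _ _ y≡f₀ -[1+ n ]  = refl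

sumSym-cong : ∀ {f h} →
  (∀ n → f (+ suc n) ≡ h (+ suc n)) → (∀ n → f -[1+ n ] ≡ h -[1+ n ]) →
  ∀ n → sumSym f n ≡ sumSym h n
sumSym-cong pos neg zero = refl
sumSym-cong pos neg (suc n) = cong₂ ℤ._+_
  (cong₂ ℤ._+_ (cong (λ v → + suc n ℤ.* + v) (pos n)) (cong (λ v → -[1+ n ] ℤ.* + v) (neg n)))
  (sumSym-cong pos neg n)

sumSym-suc-vanishing : ∀ f n → f (+ suc n) ≡ 0 → f -[1+ n ] ≡ 0 →
  sumSym f (suc n) ≡ sumSym f n
sumSym-suc-vanishing f n f₊≡0 f₋≡0
  rewrite f₊≡0 | f₋≡0 | ℤₚ.*-zeroʳ (+ suc n) | ℤₚ.*-zeroʳ -[1+ n ] =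
  ℤₚ.+-identityˡ (sumSym f n)

withHead-weight : ∀ f x → weight (withHead f x) ≡ weight f
withHead-weight f x = begin
  sumSym (setHead (seq f) x) (suc b)
    ≡⟨ sumSym-suc-vanishing _ b (support f _ (ℕₚ.n≤1+n b)) (support f _ (ℕₚ.n≤1+n b)) ⟩
  sumSym (setHead (seq f) x) b
    ≡⟨ sumSym-cong (λ _ → refl) (λ _ → refl) b ⟩
  sumSym (seq f) b ∎
  where
  open ≡-Reasoning
  b = bound f

withHead-Common : ∀ {k} f x → Common k f → x + seq f (+ 1) ≤ k → Common k (withHead f x)
withHead-Common {k} f x (adjacent , negative , oddEven) x+f₁≤k =
  adjacent′ , negative , oddEven′
  where
  adjacent′ : ∀ i → setHead (seq f) x (+ i) + setHead (seq f) x (+ suc i) ≤ k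
  adjacent′ zero    = x+f₁≤k
  adjacent′ (suc i) = adjacent (suc i)
  oddEven′ : ∀ i → ¬ (2 ∣ i) → 2 ∣ setHead (seq f) x (+ i)
  oddEven′ zero    2∤0 = contradiction (2 ∣0) 2∤0
  oddEven′ (suc i) 2∤i = oddEven (suc i) 2∤i

m+[n∸o]≤p⇔m≤p×m+n≤p+o : ∀ m n o p → m + (n ∸ o) ≤ p ⇔ (m ≤ p × m + n ≤ p + o)
m+[n∸o]≤p⇔m≤p×m+n≤p+o m n o p with ℕₚ.≤-total n o
... | inj₁ n≤o rewrite ℕₚ.m≤n⇒m∸n≡0 n≤o | ℕₚ.+-identityʳ m =
  mk⇔ (λ m≤p → m≤p , ℕₚ.+-mono-≤ m≤p n≤o) proj₁
... | inj₂ o≤n = mk⇔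
  (λ h → ℕₚ.≤-trans (ℕₚ.m≤m+n m _) h , subst (_≤ p + o) split (ℕₚ.+-monoˡ-≤ o h))
  (λ (_ , h) → ℕₚ.+-cancelʳ-≤ o _ _ (subst (_≤ p + o) (sym split) h))
  where
  split : m + (n ∸ o) + o ≡ m + n
  split = trans (ℕₚ.+-assoc m _ o) (cong (_+_ m) (ℕₚ.m∸n+n≡m o≤n))

i≤j-k+l⇔i+k≤j+l : ∀ i j k l → i ℤ.≤ j ℤ.- k ℤ.+ l ⇔ i ℤ.+ k ℤ.≤ j ℤ.+ l
i≤j-k+l⇔i+k≤j+l i j k l = mk⇔
  (λ h → subst (i ℤ.+ k ℤ.≤_) (addBack j k l) (ℤₚ.+-monoˡ-≤ k h))
  (λ h → subst₂ ℤ._≤_ (cancel i k) (moveOut j k l) (ℤₚ.+-monoˡ-≤ (ℤ.- k) h))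
  where
  addBack : ∀ j k l → j ℤ.- k ℤ.+ l ℤ.+ k ≡ j ℤ.+ l
  addBack = ℤ-solve-∀
  cancel : ∀ i k → i ℤ.+ k ℤ.- k ≡ i
  cancel = ℤ-solve-∀
  moveOut : ∀ j k l → j ℤ.+ l ℤ.- k ≡ j ℤ.- k ℤ.+ l
  moveOut = ℤ-solve-∀

+m≤+n-+o++p⇔m+o≤n+p : ∀ m n o p → + m ℤ.≤ + n ℤ.- + o ℤ.+ + p ⇔ m + o ≤ n + p
+m≤+n-+o++p⇔m+o≤n+p m n o p = mk⇔
  (λ h → ℤₚ.drop‿+≤+ (Equivalence.to (i≤j-k+l⇔i+k≤j+l (+ m) (+ n) (+ o) (+ p)) h))
  (λ h → Equivalence.from (i≤j-k+l⇔i+k≤j+l (+ m) (+ n) (+ o) (+ p)) (+≤+ h))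

[+m-+n]⊔0≡+[m∸n] : ∀ m n → (+ m ℤ.- + n) ℤ.⊔ ℤ.0ℤ ≡ + (m ∸ n)
[+m-+n]⊔0≡+[m∸n] m n rewrite ℤₚ.m-n≡m⊖n m n with ℕₚ.≤-total n m
... | inj₁ n≤m rewrite ℤₚ.⊖-≥ n≤m = ℤₚ.i≥j⇒i⊔j≡i (+≤+ z≤n)
... | inj₂ m≤n rewrite ℤₚ.⊖-≤ m≤n | ℕₚ.m≤n⇒m∸n≡0 m≤n =
  ℤₚ.i≤j⇒i⊔j≡j (ℤₚ.neg-≤-pos {n ∸ m} {0})

y₀ : ℕ → ℕ → ℕ → ℕ
y₀ j r ℓ = ℓ + (ℓ + r ∸ j)

y₀-formula : ∀ j r ℓ → + y₀ j r ℓ ≡ + ℓ ℤ.+ ((+ ℓ ℤ.- (+ j ℤ.- + r)) ℤ.⊔ ℤ.0ℤ)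
y₀-formula j r ℓ = cong (ℤ._+_ (+ ℓ)) (begin
  + (ℓ + r ∸ j)                           ≡⟨ [+m-+n]⊔0≡+[m∸n] (ℓ + r) j ⟨
  (+ ℓ ℤ.+ + r ℤ.- + j) ℤ.⊔ ℤ.0ℤ          ≡⟨ cong (ℤ._⊔ ℤ.0ℤ) (regroup (+ ℓ) (+ j) (+ r)) ⟩
  (+ ℓ ℤ.- (+ j ℤ.- + r)) ℤ.⊔ ℤ.0ℤ        ∎)
  where
  open ≡-Reasoning
  regroup : ∀ a b c → a ℤ.+ c ℤ.- b ≡ a ℤ.- (b ℤ.- c)
  regroup = ℤ-solve-∀

y₀-mono-< : ∀ j r {a b} → a < b → y₀ j r a < y₀ j r b
y₀-mono-< j r a<b =
  ℕₚ.+-mono-<-≤ a<b (ℕₚ.∸-monoˡ-≤ j (ℕₚ.+-monoˡ-≤ r (ℕₚ.<⇒≤ a<b)))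

y₀-injective : ∀ j r {a b} → y₀ j r a ≡ y₀ j r b → a ≡ b
y₀-injective j r {a} {b} eq with ℕₚ.<-cmp a b
... | tri< a<b _ _ = contradiction eq (ℕₚ.<⇒≢ (y₀-mono-< j r a<b))
... | tri≈ _ a≡b _ = a≡b
... | tri> _ _ b<a = contradiction (sym eq) (ℕₚ.<⇒≢ (y₀-mono-< j r b<a))

y₀+m≤k⇔ : ∀ j r k ℓ m → y₀ j r ℓ + m ≤ k ⇔ (ℓ + m ≤ k × 2 * ℓ + m + r ≤ k + j)
y₀+m≤k⇔ j r k ℓ m =
  subst₂ (λ a b → a ≤ k ⇔ (ℓ + m ≤ k × b ≤ k + j)) (swap ℓ m (ℓ + r ∸ j)) (double ℓ m r)
    (m+[n∸o]≤p⇔m≤p×m+n≤p+o (ℓ + m) (ℓ + r) j k)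
  where
  swap : ∀ a b c → a + b + c ≡ a + c + b
  swap = ℕ-solve-∀
  double : ∀ a b c → a + b + (a + c) ≡ 2 * a + b + c
  double = ℕ-solve-∀

module _ (j r k : ℕ) where

  level : Σ GFS (Y° j r k) → ℕ
  level (_ , _ , ℓ , _) = ℓ

  head≡y₀-level : ∀ y → seq (proj₁ y) (+ 0) ≡ y₀ j r (level y)
  head≡y₀-level (_ , _ , ℓ , _ , f₀≡) = ℤₚ.+-injective (trans f₀≡ (sym (y₀-formula j r ℓ)))

  Y→Z : Σ GFS (Y° j r k) → Σ GFS (Z° j r k)
  Y→Z y@(f , common , ℓ , ℓ≤j , _) =
    withHead f ℓ , withHead-Common f ℓ common (proj₁ bounds) , ℓ≤j ,
    Equivalence.from (+m≤+n-+o++p⇔m+o≤n+p _ k r j) (proj₂ bounds)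
    where
    bounds : ℓ + seq f (+ 1) ≤ k × 2 * ℓ + seq f (+ 1) + r ≤ k + j
    bounds = Equivalence.to (y₀+m≤k⇔ j r k ℓ _)
      (subst (λ x → x + seq f (+ 1) ≤ k) (head≡y₀-level y) (proj₁ common 0))

  Z→Y : Σ GFS (Z° j r k) → Σ GFS (Y° j r k)
  Z→Y (f , common , f₀≤j , bound₀) =
    withHead f (y₀ j r f₀) ,
    withHead-Common f (y₀ j r f₀) common (Equivalence.from (y₀+m≤k⇔ j r k f₀ _)
      (proj₁ common 0 , Equivalence.to (+m≤+n-+o++p⇔m+o≤n+p _ k r j) bound₀)) ,
    f₀ , f₀≤j , y₀-formula j r f₀
    where
    f₀ = seq f (+ 0)

  Y≅Z : WeightPreservingBijection (Y° j r k) (Z° j r k)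
  Y≅Z = record
    { to        = Y→Z
    ; from      = Z→Y
    ; to-cong   = λ x y x≈y → withHead-cong (proj₁ x) (proj₁ y) x≈y (y₀-injective j r
        (trans (sym (head≡y₀-level x)) (trans (x≈y (+ 0)) (head≡y₀-level y))))
    ; from-cong = λ x y x≈y → withHead-cong (proj₁ x) (proj₁ y) x≈y (cong (y₀ j r) (x≈y (+ 0)))
    ; from∘to   = λ x → withHead-withHead (proj₁ x) (level x) (sym (head≡y₀-level x))
    ; to∘from   = λ y → withHead-withHead (proj₁ y) (y₀ j r (seq (proj₁ y) (+ 0))) refl
    ; to-weight = λ x → withHead-weight (proj₁ x) (level x)
    }

proposition3p5 : (j r k : ℕ) → j + r ≤ k →
    WeightPreservingBijection (Y° j r k) (Z° j r k)
proposition3p5 j r k _ = Y≅Z j r k
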